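{- For every $n\ge 1$, $T_n(x,s,q)$ equals the weight of the set of all tilings of the $n$-board whose last tile (the tile covering cell $n$) is either a white square or a domino. Consequently, for $n>0$, $$T_n(x,s,q)=xU_{n-1}(x,s,q)+q^{n-1}sU_{n-2}(x,s,q).$$
   Context: Let $q$ be a real number with $q\neq -1$. $T_0(x,s,q)=1$, $T_1(x,s,q)=x$, $T_n(x,s,q)=(1+q^{n-1})xT_{n-1}(x,s,q)+q^{n-1}sT_{n-2}(x,s,q)$ for $n\ge2$; $U_{ -1}(x,s,q)=0$, $U_0(x,s,q)=1$, $U_n(x,s,q)=(1+q^{n})xU_{n-1}(x,s,q)+q^{n-1}sU_{n-2}(x,s,q)$ for $n\ge 1$. The $n$-board consists of cells $1,\dots,n$; a tiling is a covering of all cells by non-overlapping tiles, each a white square (one cell), a black square (one cell) or a domino (two adjacent cells $i-1,i$). Weights: white square $x$; black square at position $i$: $q^ix$; domino covering $i-1,i$: $q^{i-1}s$; a tiling has the product of its tiles' weights, a set of tilings the sum of its elements' weights. -}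

module Defs where

open import Level using (Level)
open import Data.Nat using (ℕ; zero; suc)
open import Data.Bool using (Bool; true; false)
open import Data.List using (List; []; _∷_; map; _++_)
open import Algebra.Bundles using (CommutativeRing)

data Tiling : ℕ → Set where
  empty : Tiling zero
  _▹white  : ∀ {n} → Tiling n → Tiling (suc n)
  _▹black  : ∀ {n} → Tiling n → Tiling (suc n)
  _▹domino : ∀ {n} → Tiling n → Tiling (suc (suc n))

tilings : (n : ℕ) → List (Tiling n)
tilings zero = empty ∷ []
tilings (suc zero) = map _▹white (tilings zero) ++ map _▹black (tilings zero)
tilings (suc (suc n)) =
  map _▹white (tilings (suc n)) ++ map _▹black (tilings (suc n))
    ++ map _▹domino (tilings n)

lastWhiteOrDomino : ∀ {n} → Tiling n → Bool
lastWhiteOrDomino empty = false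
lastWhiteOrDomino (t ▹white) = true
lastWhiteOrDomino (t ▹black) = false
lastWhiteOrDomino (t ▹domino) = true

module _ {c ℓ : Level} (R : CommutativeRing c ℓ) where
  open CommutativeRing R

  pow : Carrier → ℕ → Carrier
  pow a zero = 1#
  pow a (suc k) = a * pow a k

  module _ (x s q : Carrier) where

    -- weight of a tiling: white square x; black square at position i: q^i x;
    -- domino covering i-1, i: q^(i-1) s.
    weight : ∀ {n} → Tiling n → Carrier
    weight empty = 1#
    weight (t ▹white) = weight t * x
    weight {suc n} (t ▹black) = weight t * (pow q (suc n) * x)
    weight {suc (suc n)} (t ▹domino) = weight t * (pow q (suc n) * s)

    sumWeights : ∀ {n} → List (Tiling n) → Carrier
    sumWeights [] = 0#
    sumWeights (t ∷ ts) = weight t + sumWeights ts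

    filterWD : ∀ {n} → List (Tiling n) → List (Tiling n)
    filterWD [] = []
    filterWD (t ∷ ts) with lastWhiteOrDomino t
    ... | true  = t ∷ filterWD ts
    ... | false = filterWD ts

    weightWD : ℕ → Carrier
    weightWD n = sumWeights (filterWD (tilings n))

    T : ℕ → Carrier
    T zero = 1#
    T (suc zero) = x
    T (suc (suc k)) =
      (1# + pow q (suc k)) * x * T (suc k) + pow q (suc k) * s * T k

    -- Ush k = U_{k-1}(x,s,q)  (shifted so that Ush 0 = U_{-1} = 0)
    Ush : ℕ → Carrier
    Ush zero = 0#
    Ush (suc zero) = 1#
    Ush (suc (suc k)) =
      (1# + pow q (suc k)) * x * Ush (suc k) + pow q k * s * Ush k

    U : ℕ → Carrier
    U n = Ush (suc n)

module Submission where

-- Classify tilings by their last tile.  Appending a white square, a black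
-- square or a domino shows that the total weight of the tilings of the
-- n-board satisfies the recurrence of U, so it equals U_n.  Dropping the
-- black endings leaves x U_{n-1} + q^{n-1} s U_{n-2}, and this expression
-- satisfies the recurrence of T (one unfolding of the recurrence of U
-- suffices) with the same initial values.

open import Defs
open import Level using (Level)
open import Data.Nat using (ℕ; _≤_; _∸_; zero; suc)
open import Data.Product using (_×_; _,_)
open import Data.Bool using (true; false)
open import Data.List using (List; []; _∷_; map; _++_)
open import Relation.Nullary using (¬_)
open import Relation.Binary.PropositionalEquality as ≡ using (_≡_)
open import Algebra.Bundles using (CommutativeRing)
import Relation.Binary.Reasoning.Setoid as SetoidReasoning
import Algebra.Solver.Ring.NaturalCoefficients.Default as NaturalCoefficientSolver

module _ {c ℓ : Level} (R : CommutativeRing c ℓ) where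
  open CommutativeRing R
  open SetoidReasoning setoid
  open NaturalCoefficientSolver commutativeSemiring using (solve; _:=_; _:+_; _:*_)

  1+-*-distribʳ : ∀ a b → (1# + a) * b ≈ b + a * b
  1+-*-distribʳ a b = trans (distribʳ b 1# a) (+-congʳ (*-identityˡ b))

  TviaU-recurrence-identity : ∀ x s a b p u₀ u₁ u₂ →
    x * ((x + b * x) * u₂ + a * s * u₁) + b * s * ((x + a * x) * u₁ + p * s * u₀)
      ≈ (x + b * x) * (x * u₂ + a * s * u₁) + b * s * (x * u₁ + p * s * u₀)
  TviaU-recurrence-identity = solve 8 (λ x s a b p u₀ u₁ u₂ →
    x :* ((x :+ b :* x) :* u₂ :+ a :* s :* u₁) :+ b :* s :* ((x :+ a :* x) :* u₁ :+ p :* s :* u₀)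
      := (x :+ b :* x) :* (x :* u₂ :+ a :* s :* u₁) :+ b :* s :* (x :* u₁ :+ p :* s :* u₀)) refl

  module _ (x s q : Carrier) where

    y*1#+1#*s*0#≈y : ∀ y → y * 1# + 1# * s * 0# ≈ y
    y*1#+1#*s*0#≈y y = trans (+-cong (*-identityʳ y) (zeroʳ _)) (+-identityʳ y)

    TviaU : ℕ → Carrier
    TviaU m = x * U R x s q m + pow R q m * s * Ush R x s q m

    TviaU-recurrence : ∀ k →
      TviaU (suc (suc k))
        ≈ (1# + pow R q (suc (suc k))) * x * TviaU (suc k) + pow R q (suc (suc k)) * s * TviaU k
    TviaU-recurrence k = begin
      x * ((1# + b) * x * u₂ + a * s * u₁) + b * s * ((1# + a) * x * u₁ + p * s * u₀)
        ≈⟨ +-cong (*-congˡ (+-congʳ (*-congʳ (1+-*-distribʳ b x))))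
                  (*-congˡ (+-congʳ (*-congʳ (1+-*-distribʳ a x)))) ⟩
      x * ((x + b * x) * u₂ + a * s * u₁) + b * s * ((x + a * x) * u₁ + p * s * u₀)
        ≈⟨ TviaU-recurrence-identity x s a b p u₀ u₁ u₂ ⟩
      (x + b * x) * TviaU (suc k) + b * s * TviaU k
        ≈⟨ +-congʳ (*-congʳ (sym (1+-*-distribʳ b x))) ⟩
      (1# + b) * x * TviaU (suc k) + b * s * TviaU k ∎
      where
      p = pow R q k
      a = pow R q (suc k)
      b = pow R q (suc (suc k))
      u₀ = Ush R x s q k
      u₁ = Ush R x s q (suc k)
      u₂ = Ush R x s q (suc (suc k))

    T≈TviaU : ∀ m → T R x s q (suc m) ≈ TviaU m
    T≈TviaU zero = sym (y*1#+1#*s*0#≈y x)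
    T≈TviaU (suc zero) =
      sym (+-congʳ (trans (*-congˡ (y*1#+1#*s*0#≈y _)) (*-comm x _)))
    T≈TviaU (suc (suc k)) = begin
      (1# + b) * x * T R x s q (suc (suc k)) + b * s * T R x s q (suc k)
        ≈⟨ +-cong (*-congˡ (T≈TviaU (suc k))) (*-congˡ (T≈TviaU k)) ⟩
      (1# + b) * x * TviaU (suc k) + b * s * TviaU k
        ≈⟨ sym (TviaU-recurrence k) ⟩
      TviaU (suc (suc k)) ∎
      where
      b = pow R q (suc (suc k))

    sumWeights-++ : ∀ {n} (ts us : List (Tiling n)) →
      sumWeights R x s q (ts ++ us) ≈ sumWeights R x s q ts + sumWeights R x s q us
    sumWeights-++ [] us = sym (+-identityˡ _)
    sumWeights-++ (t ∷ ts) us = trans (+-congˡ (sumWeights-++ ts us)) (sym (+-assoc _ _ _))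

    sumWeights-map : ∀ {m n} (f : Tiling m → Tiling n) (k : Carrier) →
      (∀ t → weight R x s q (f t) ≈ weight R x s q t * k) →
      ∀ ts → sumWeights R x s q (map f ts) ≈ sumWeights R x s q ts * k
    sumWeights-map f k weight-f [] = sym (zeroˡ k)
    sumWeights-map f k weight-f (t ∷ ts) =
      trans (+-cong (weight-f t) (sumWeights-map f k weight-f ts)) (sym (distribʳ k _ _))

    filterWD-++ : ∀ {n} (ts us : List (Tiling n)) →
      filterWD R x s q (ts ++ us) ≡ filterWD R x s q ts ++ filterWD R x s q us
    filterWD-++ [] us = ≡.refl
    filterWD-++ (t ∷ ts) us with lastWhiteOrDomino t
    ... | true  = ≡.cong (t ∷_) (filterWD-++ ts us)
    ... | false = filterWD-++ ts us

    filterWD-map-accepted : ∀ {m n} (f : Tiling m → Tiling n) →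
      (∀ t → lastWhiteOrDomino (f t) ≡ true) →
      ∀ ts → filterWD R x s q (map f ts) ≡ map f ts
    filterWD-map-accepted f accepted [] = ≡.refl
    filterWD-map-accepted f accepted (t ∷ ts) rewrite accepted t =
      ≡.cong (f t ∷_) (filterWD-map-accepted f accepted ts)

    filterWD-map-rejected : ∀ {m n} (f : Tiling m → Tiling n) →
      (∀ t → lastWhiteOrDomino (f t) ≡ false) →
      ∀ ts → filterWD R x s q (map f ts) ≡ []
    filterWD-map-rejected f rejected [] = ≡.refl
    filterWD-map-rejected f rejected (t ∷ ts) rewrite rejected t =
      filterWD-map-rejected f rejected ts

    filterWD-tilings : ∀ k →
      filterWD R x s q (tilings (suc (suc k)))
        ≡ map _▹white (tilings (suc k)) ++ map _▹domino (tilings k)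
    filterWD-tilings k = ≡.trans (filterWD-++ (map _▹white ts₁) _)
      (≡.cong₂ _++_ (filterWD-map-accepted _▹white (λ _ → ≡.refl) ts₁)
        (≡.trans (filterWD-++ (map _▹black ts₁) _)
          (≡.cong₂ _++_ (filterWD-map-rejected _▹black (λ _ → ≡.refl) ts₁)
                        (filterWD-map-accepted _▹domino (λ _ → ≡.refl) (tilings k)))))
      where
      ts₁ = tilings (suc k)

    totalWeight : ℕ → Carrier
    totalWeight n = sumWeights R x s q (tilings n)

    totalWeight-recurrence : ∀ k →
      totalWeight (suc (suc k))
        ≈ (1# + pow R q (suc (suc k))) * x * totalWeight (suc k) + pow R q (suc k) * s * totalWeight k
    totalWeight-recurrence k = begin
      sumWeights R x s q (map _▹white ts₁ ++ map _▹black ts₁ ++ map _▹domino ts₀)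
        ≈⟨ trans (sumWeights-++ (map _▹white ts₁) _) (+-congˡ (sumWeights-++ (map _▹black ts₁) _)) ⟩
      sumWeights R x s q (map _▹white ts₁)
        + (sumWeights R x s q (map _▹black ts₁) + sumWeights R x s q (map _▹domino ts₀))
        ≈⟨ +-cong (sumWeights-map _▹white x (λ _ → refl) ts₁)
                  (+-cong (sumWeights-map _▹black (b * x) (λ _ → refl) ts₁)
                          (sumWeights-map _▹domino (a * s) (λ _ → refl) ts₀)) ⟩
      w₁ * x + (w₁ * (b * x) + w₀ * (a * s))
        ≈⟨ sym (+-assoc _ _ _) ⟩
      (w₁ * x + w₁ * (b * x)) + w₀ * (a * s)
        ≈⟨ +-congʳ (sym (distribˡ w₁ x (b * x))) ⟩
      w₁ * (x + b * x) + w₀ * (a * s)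
        ≈⟨ +-congʳ (*-congˡ (sym (1+-*-distribʳ b x))) ⟩
      w₁ * ((1# + b) * x) + w₀ * (a * s)
        ≈⟨ +-cong (*-comm w₁ _) (*-comm w₀ _) ⟩
      (1# + b) * x * w₁ + a * s * w₀ ∎
      where
      a = pow R q (suc k)
      b = pow R q (suc (suc k))
      ts₀ = tilings k
      ts₁ = tilings (suc k)
      w₀ = totalWeight k
      w₁ = totalWeight (suc k)

    totalWeight≈U : ∀ n → totalWeight n ≈ U R x s q n
    totalWeight≈U zero = +-identityʳ 1#
    totalWeight≈U (suc zero) = begin
      1# * x + (1# * (q * 1# * x) + 0#)
        ≈⟨ +-cong (*-identityˡ x) (trans (+-identityʳ _) (*-identityˡ _)) ⟩
      x + q * 1# * x
        ≈⟨ sym (1+-*-distribʳ (q * 1#) x) ⟩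
      (1# + q * 1#) * x
        ≈⟨ sym (y*1#+1#*s*0#≈y _) ⟩
      U R x s q 1 ∎
    totalWeight≈U (suc (suc k)) =
      trans (totalWeight-recurrence k)
            (+-cong (*-congˡ (totalWeight≈U (suc k))) (*-congˡ (totalWeight≈U k)))

    weightWD-recurrence : ∀ k →
      weightWD R x s q (suc (suc k))
        ≈ x * totalWeight (suc k) + pow R q (suc k) * s * totalWeight k
    weightWD-recurrence k = begin
      sumWeights R x s q (filterWD R x s q (tilings (suc (suc k))))
        ≡⟨ ≡.cong (sumWeights R x s q) (filterWD-tilings k) ⟩
      sumWeights R x s q (map _▹white ts₁ ++ map _▹domino ts₀)
        ≈⟨ sumWeights-++ (map _▹white ts₁) _ ⟩
      sumWeights R x s q (map _▹white ts₁) + sumWeights R x s q (map _▹domino ts₀)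
        ≈⟨ +-cong (sumWeights-map _▹white x (λ _ → refl) ts₁)
                  (sumWeights-map _▹domino (pow R q (suc k) * s) (λ _ → refl) ts₀) ⟩
      totalWeight (suc k) * x + totalWeight k * (pow R q (suc k) * s)
        ≈⟨ +-cong (*-comm _ x) (*-comm _ _) ⟩
      x * totalWeight (suc k) + pow R q (suc k) * s * totalWeight k ∎
      where
      ts₀ = tilings k
      ts₁ = tilings (suc k)

    weightWD≈TviaU : ∀ m → weightWD R x s q (suc m) ≈ TviaU m
    weightWD≈TviaU zero =
      trans (+-identityʳ _) (trans (*-identityˡ x) (sym (y*1#+1#*s*0#≈y x)))
    weightWD≈TviaU (suc k) =
      trans (weightWD-recurrence k)
            (+-cong (*-congˡ (totalWeight≈U (suc k))) (*-congˡ (totalWeight≈U k)))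

theorem2p4 : ∀ {c ℓ : Level} (R : CommutativeRing c ℓ) →
    let open CommutativeRing R in
    (x s q : Carrier) → ¬ (q ≈ - 1#) →
    (n : ℕ) → 1 ≤ n →
      (T R x s q n ≈ weightWD R x s q n)
      × (T R x s q n ≈ x * U R x s q (n ∸ 1)
                         + pow R q (n ∸ 1) * s * Ush R x s q (n ∸ 1))
theorem2p4 R x s q _ (suc m) _ =
  trans (T≈TviaU R x s q m) (sym (weightWD≈TviaU R x s q m)) , T≈TviaU R x s q m
  where open CommutativeRing R
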